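{- Let $X=\{1,\dots,n\}$, $\boldsymbol{\alpha}$ a sequence of nonnegative integers, $U\subseteq X\times X$, and suppose $\operatorname{maj}'_U$ and $\operatorname{inv}'_U$ are equidistributed on $\mathcal{R}(\boldsymbol{\alpha})$. Let $w=w_kw_{k-1}\cdots w_1$ be a maximal chain word in $\mathcal{R}(\boldsymbol{\alpha})$ (for $U$) formed from the maximal chains $w_1,\dots,w_k$. Then: (i) for each chain $w_j=y_1y_2\cdots y_\ell$ and all $1\le r<s\le \ell$, $(y_r,y_s)\in U$ or $(y_s,y_r)\in U$; (ii) for $i>j$, writing $w_j=y_1\cdots y_\ell$, each letter $y$ of $w_i$ is related to exactly $\ell-1$ letters of $w_j$; i.e. there is a unique $r\in\{1,\dots,\ell\}$ with $(y,y_r)\notin U$ and $(y_r,y)\notin U$; moreover $(y_s,y)\in U$ for $1\le s<r$ and $(y,y_s)\in U$ for $r<s\le\ell$.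
   Context: $\mathcal{R}(\boldsymbol{\alpha})$ is the set of words with exactly $\alpha_i$ occurrences of $i$. $\operatorname{inv}'_U w=\#\{(i,j):i<j,\ (x_i,x_j)\in U\}$, $\operatorname{maj}'_U w=\sum i$ over $1\le i\le m-1$ with $(x_i,x_{i+1})\in U$ for $w=x_1\cdots x_m$; equidistributed means equal generating functions $\sum_w q^{(\cdot)}$ over $\mathcal{R}(\boldsymbol{\alpha})$. Let $(\boldsymbol{\alpha},U)$ be the directed graph whose vertices are the elements of the multiset $\{1^{\alpha_1},\dots,n^{\alpha_n}\}$ (each copy a separate vertex), with an edge $u\to v$ between distinct vertices whenever (value of $u$, value of $v$) $\in U$. A descending chain is a sequence of distinct vertices $y_1\to y_2\to\cdots\to y_\ell$ in this graph. A maximal chain word is obtained as follows: choose a descending chain $w_1$ of maximum possible length in $(\boldsymbol{\alpha},U)$, delete its vertices, choose a descending chain $w_2$ of maximum possible length among the remaining vertices, and so on until no vertices remain, producing chains $w_1,\dots,w_k$ (each written as a word in chain order); the word is the concatenation $w=w_kw_{k-1}\cdots w_1\in\mathcal{R}(\boldsymbol{\alpha})$. -}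

module Defs where

open import Data.Nat using (ℕ; zero; suc; _+_; _≤_; _<_)
open import Data.Nat.Properties using (_≟_)
open import Data.Bool using (Bool; true; false; if_then_else_)
open import Data.Fin using (Fin; toℕ)
import Data.Fin.Properties as FinP
open import Data.List using (List; []; _∷_; length; map; filter; concat; concatMap;
  reverse; allFin; lookup; _++_)
open import Data.Nat.ListAction using (sum)
open import Data.List.Membership.Propositional using (_∈_; _∉_)
open import Data.List.Relation.Unary.All using (All; all?)
open import Data.List.Relation.Unary.Unique.Propositional using (Unique)
open import Data.List.Relation.Unary.Linked using (Linked)
open import Data.Product using (Σ; _×_; _,_; proj₁; ∃)
open import Data.Sum using (_⊎_)
open import Relation.Binary.PropositionalEquality using (_≡_; _≢_)

-- Letters are elements of X = Fin n (standing for {1,…,n}).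
-- A relation U ⊆ X × X is given by its (decidable) characteristic function.
Rel₂ : ℕ → Set
Rel₂ n = Fin n → Fin n → Bool

occ : ∀ {n} → Fin n → List (Fin n) → ℕ
occ i w = length (filter (FinP._≟_ i) w)

count : ∀ {n} → (Fin n → Bool) → List (Fin n) → ℕ
count p [] = 0
count p (x ∷ xs) = (if p x then 1 else 0) + count p xs

inv' : ∀ {n} → Rel₂ n → List (Fin n) → ℕ
inv' U [] = 0
inv' U (x ∷ xs) = count (U x) xs + inv' U xs

majFrom : ∀ {n} → Rel₂ n → ℕ → List (Fin n) → ℕ
majFrom U k [] = 0
majFrom U k (x ∷ []) = 0
majFrom U k (x ∷ y ∷ ys) = (if U x y then k else 0) + majFrom U (suc k) (y ∷ ys)

maj' : ∀ {n} → Rel₂ n → List (Fin n) → ℕ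
maj' U w = majFrom U 1 w

allWords : ∀ n → ℕ → List (List (Fin n))
allWords n zero = [] ∷ []
allWords n (suc m) = concatMap (λ x → map (x ∷_) (allWords n m)) (allFin n)

HasContent : ∀ {n} → (Fin n → ℕ) → List (Fin n) → Set
HasContent {n} α w = All (λ i → occ i w ≡ α i) (allFin n)

R : ∀ {n} → (Fin n → ℕ) → List (List (Fin n))
R {n} α = filter (λ w → all? (λ i → occ i w ≟ α i) (allFin n))
                 (allWords n (sum (map α (allFin n))))

-- maj'_U and inv'_U are equidistributed on R(α): for every k, the coefficient of q^k
-- in Σ_{w ∈ R(α)} q^{maj' w} and in Σ_{w ∈ R(α)} q^{inv' w} agree.
Equidistributed : ∀ {n} → Rel₂ n → (Fin n → ℕ) → Set
Equidistributed U α = ∀ k →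
  length (filter (λ w → maj' U w ≟ k) (R α)) ≡ length (filter (λ w → inv' U w ≟ k) (R α))

-- Vertices of the graph (α,U): the j-th copy (j < α i) of the value i.
Vertex : ∀ {n} → (Fin n → ℕ) → Set
Vertex {n} α = Σ (Fin n) (λ i → Fin (α i))

val : ∀ {n} {α : Fin n → ℕ} → Vertex α → Fin n
val = proj₁

Edge : ∀ {n} {α : Fin n → ℕ} → Rel₂ n → Vertex α → Vertex α → Set
Edge U u v = u ≢ v × U (val u) (val v) ≡ true

IsChain : ∀ {n} {α : Fin n → ℕ} → Rel₂ n → List (Vertex α) → Set
IsChain U c = Unique c × Linked (Edge U) c

-- MaxChainSeq U used (w_j ∷ w_{j+1} ∷ … ∷ w_k): `used` are the vertices deleted so far;
-- each w_j is a (nonempty) descending chain among the remaining vertices, of maximum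
-- possible length among such chains; the process stops exactly when no vertex remains.
data MaxChainSeq {n} {α : Fin n → ℕ} (U : Rel₂ n) (used : List (Vertex α))
     : List (List (Vertex α)) → Set where
  done : (∀ v → v ∈ used) → MaxChainSeq U used []
  step : ∀ {c cs} →
         c ≢ [] →
         IsChain U c →
         All (_∉ used) c →
         (∀ d → IsChain U d → All (_∉ used) d → length d ≤ length c) →
         MaxChainSeq U (used ++ c) cs →
         MaxChainSeq U used (c ∷ cs)

MaxChains : ∀ {n} {α : Fin n → ℕ} → Rel₂ n → List (List (Vertex α)) → Set
MaxChains U ws = MaxChainSeq U [] ws

maxChainWord : ∀ {n} {α : Fin n → ℕ} → List (List (Vertex α)) → List (Fin n)
maxChainWord ws = concat (reverse (map (map val) ws))

Unrelated : ∀ {n} → Rel₂ n → Fin n → Fin n → Set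
Unrelated U a b = U a b ≡ false × U b a ≡ false

-- Let inc w be the number of pairs of positions of w carrying incomparable letters (neither order in
-- U); it depends only on the content of w. Every word satisfies inv' + inc ≤ C(m,2), while
-- maj' + comaj = C(m,2), where comaj sums the positions i with (x_i, x_{i+1}) ∉ U. Equidistribution
-- gives v ∈ R(α) with inv' v = maj' w for the maximal chain word w, so inc w ≤ comaj w. Steps inside
-- a chain lie in U, so comaj w is at most the sum of the positions where consecutive chains meet.
-- Conversely, by maximality of w_j every vertex of a later chain is incomparable with some letter of
-- w_j (otherwise it could be inserted into w_j), so inc w is at least that same sum. Hence equality
-- holds throughout: no chain contains an incomparable pair, and every later vertex is incomparable
-- with exactly one letter of w_j; non-insertability again decides, for every other letter of w_j,
-- in which order it is related to the vertex.
module Submission where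

open import Defs
open import Data.Nat.Properties
open import Algebra.Properties.CommutativeMonoid.Sum +-0-commutativeMonoid
  using (sum-syntax; ∑-distrib-+; sum-cong-≗; sum-replicate-zero)
open import Data.Bool using (Bool; true; false; not; _∨_; if_then_else_)
open import Data.Bool.Properties using (∨-comm)
open import Data.Empty using (⊥; ⊥-elim)
open import Data.Fin using (Fin; zero; suc; toℕ)
import Data.Fin.Properties as Fin
open import Data.List using (List; []; _∷_; [_]; _++_; length; map; filter; concat;
  lookup; allFin; tabulate; head; last)
open import Data.List.Membership.Propositional using (_∈_; _∉_)
open import Data.List.Membership.Propositional.Properties using (∈-++⁺ˡ; ∈-++⁺ʳ; ∈-map⁺;
  ∈-map⁻; ∈-concat⁺′; ∈-filter⁺; ∈-filter⁻; ∈-allFin; ∈-lookup)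
open import Data.List.Membership.Propositional.Properties.WithK using (unique∧set⇒bag)
open import Data.List.Properties using (++-assoc; ++-identityʳ; map-++; map-∘; map-cong; length-map;
  length-++-sucʳ; length-tabulate; map-tabulate)
open import Data.List.Relation.Binary.BagAndSetEquality using (∼bag⇒↭)
open import Data.List.Relation.Binary.Permutation.Propositional using (_↭_; ↭-refl; ↭-trans)
import Data.List.Relation.Binary.Permutation.Propositional.Properties as ↭
open import Data.List.Relation.Unary.All using (All; []; _∷_)
import Data.List.Relation.Unary.All as All
import Data.List.Relation.Unary.All.Properties as All
open import Data.List.Relation.Unary.AllPairs using ([]; _∷_)
open import Data.List.Relation.Unary.Any using (here; there)
open import Data.List.Relation.Unary.Linked as Linked using (Linked; []; [-]; _∷_)
open import Data.List.Relation.Unary.Unique.Propositional using (Unique)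
import Data.List.Relation.Unary.Unique.Propositional.Properties as Unique
open import Data.Maybe using (just)
open import Data.Maybe.Relation.Binary.Connected using (Connected; just; just-nothing; nothing-just)
open import Data.Nat using (ℕ; zero; suc; _+_; _*_; _≤_; _<_; z≤n; s≤s)
open import Data.Nat.ListAction using (sum)
open import Data.Nat.Tactic.RingSolver using (solve-∀)
open import Data.Product using (Σ; ∃-syntax; _×_; _,_; proj₁; proj₂)
open import Data.Sum using (_⊎_; inj₁; inj₂)
open import Data.Unit using (⊤; tt)
open import Function using (_∘_; mk⇔)
open import Relation.Nullary using (Dec; yes; no; does)
open import Relation.Binary.PropositionalEquality hiding ([_])

-- Content of a word

δ : ∀ {n} → Fin n → Fin n → ℕ
δ i a = if does (i Fin.≟ a) then 1 else 0

occ-∷ : ∀ {n} (i a : Fin n) w → occ i (a ∷ w) ≡ δ i a + occ i w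
occ-∷ i a w with i Fin.≟ a
... | yes _ = refl
... | no _ = refl

∑-δ : ∀ {n} (a : Fin n) (g : Fin n → ℕ) → ∑[ i < n ] (δ i a * g i) ≡ g a
∑-δ {suc n} zero g = trans (cong (g zero + 0 +_) (sum-replicate-zero n))
                           (trans (+-identityʳ _) (+-identityʳ _))
∑-δ {suc n} (suc a) g = ∑-δ a (g ∘ suc)

sum-map≡∑-occ : ∀ {n} (g : Fin n → ℕ) w → sum (map g w) ≡ ∑[ i < n ] (occ i w * g i)
sum-map≡∑-occ {n} g [] = sym (sum-replicate-zero n)
sum-map≡∑-occ {n} g (a ∷ w) = begin
  g a + sum (map g w)
    ≡⟨ cong₂ _+_ (sym (∑-δ a g)) (sum-map≡∑-occ g w) ⟩
  ∑[ i < n ] (δ i a * g i) + ∑[ i < n ] (occ i w * g i)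
    ≡⟨ sym (∑-distrib-+ (λ i → δ i a * g i) (λ i → occ i w * g i)) ⟩
  ∑[ i < n ] (δ i a * g i + occ i w * g i)
    ≡⟨ sum-cong-≗ occ-step ⟩
  ∑[ i < n ] (occ i (a ∷ w) * g i) ∎
  where
  open ≡-Reasoning
  occ-step : ∀ i → δ i a * g i + occ i w * g i ≡ occ i (a ∷ w) * g i
  occ-step i = trans (sym (*-distribʳ-+ (g i) (δ i a) (occ i w)))
                     (cong (_* g i) (sym (occ-∷ i a w)))

record SameContent {n} (v w : List (Fin n)) : Set where
  constructor same-content
  field occ-≡ : ∀ i → occ i v ≡ occ i w

open SameContent

sum-map-content : ∀ {n} (g : Fin n → ℕ) {v w} → SameContent v w → sum (map g v) ≡ sum (map g w)
sum-map-content g {v} {w} same = begin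
  sum (map g v)                   ≡⟨ sum-map≡∑-occ g v ⟩
  ∑[ i < _ ] (occ i v * g i)      ≡⟨ sum-cong-≗ (λ i → cong (_* g i) (occ-≡ same i)) ⟩
  ∑[ i < _ ] (occ i w * g i)      ≡⟨ sym (sum-map≡∑-occ g w) ⟩
  sum (map g w)                   ∎
  where open ≡-Reasoning

count≡sum-map : ∀ {n} (f : Fin n → Bool) w →
                count f w ≡ sum (map (λ a → if f a then 1 else 0) w)
count≡sum-map f [] = refl
count≡sum-map f (a ∷ w) = cong (_ +_) (count≡sum-map f w)

count-content : ∀ {n} (f : Fin n → Bool) {v w} → SameContent v w → count f v ≡ count f w
count-content f {v} {w} same =
  trans (count≡sum-map f v)
        (trans (sum-map-content (λ a → if f a then 1 else 0) same) (sym (count≡sum-map f w)))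

length≡sum-map-1 : ∀ {A : Set} (w : List A) → length w ≡ sum (map (λ _ → 1) w)
length≡sum-map-1 [] = refl
length≡sum-map-1 (a ∷ w) = cong suc (length≡sum-map-1 w)

length≡∑-occ : ∀ {n} (w : List (Fin n)) → length w ≡ ∑[ i < n ] occ i w
length≡∑-occ w = trans (length≡sum-map-1 w)
  (trans (sum-map≡∑-occ (λ _ → 1) w) (sum-cong-≗ (λ i → *-identityʳ (occ i w))))

length-content : ∀ {n} {v w : List (Fin n)} → SameContent v w → length v ≡ length w
length-content {v = v} {w} same =
  trans (length≡∑-occ v) (trans (sum-cong-≗ (occ-≡ same)) (sym (length≡∑-occ w)))

sum-map-allFin : ∀ {n} (f : Fin n → ℕ) → sum (map f (allFin n)) ≡ ∑[ i < n ] f i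
sum-map-allFin f = trans (cong sum (map-tabulate (λ i → i) f)) (sum-tabulate f)
  where
  sum-tabulate : ∀ {m} (h : Fin m → ℕ) → sum (tabulate h) ≡ ∑[ i < m ] h i
  sum-tabulate {zero} h = refl
  sum-tabulate {suc m} h = cong (h zero +_) (sum-tabulate (h ∘ suc))

-- The set R(α)

∈-allWords : ∀ {n} (w : List (Fin n)) → w ∈ allWords n (length w)
∈-allWords [] = here refl
∈-allWords {n} (a ∷ w) =
  ∈-concat⁺′ (∈-map⁺ (a ∷_) (∈-allWords w))
             (∈-map⁺ (λ x → map (x ∷_) (allWords n (length w))) (∈-allFin a))

inhabited-of-same-length : ∀ {A : Set} {x : A} {xs ys : List A} →
                           x ∈ xs → length xs ≡ length ys → ∃[ y ] y ∈ ys
inhabited-of-same-length {ys = y ∷ _} _ _ = y , here refl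
inhabited-of-same-length {xs = _ ∷ _} {ys = []} _ ()

module _ {n : ℕ} {α : Fin n → ℕ} where

  private
    hasContent? : (w : List (Fin n)) → Dec (HasContent α w)
    hasContent? w = All.all? (λ i → occ i w ≟ α i) (allFin n)

  ∈R⁺ : ∀ {w} → (∀ i → occ i w ≡ α i) → w ∈ R α
  ∈R⁺ {w} content = ∈-filter⁺ hasContent?
    (subst (λ m → w ∈ allWords n m) length-w (∈-allWords w)) (All.tabulate (λ {i} _ → content i))
    where
    length-w : length w ≡ sum (map α (allFin n))
    length-w = trans (length≡∑-occ w) (trans (sum-cong-≗ content) (sym (sum-map-allFin α)))

  ∈R⁻ : ∀ {w} → w ∈ R α → ∀ i → occ i w ≡ α i
  ∈R⁻ w∈R i =
    All.lookup (proj₂ (∈-filter⁻ hasContent? {xs = allWords n (sum (map α (allFin n)))} w∈R)) (∈-allFin i)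

  ∃-inv'≡maj' : ∀ {U w} → Equidistributed U α → w ∈ R α → ∃[ v ] v ∈ R α × inv' U v ≡ maj' U w
  ∃-inv'≡maj' {U} {w} equi w∈R
    with v , v∈ ← inhabited-of-same-length (∈-filter⁺ (λ v → maj' U v ≟ maj' U w) w∈R refl)
                                           (equi (maj' U w))
    = v , ∈-filter⁻ (λ v → inv' U v ≟ maj' U w) {xs = R α} v∈

-- Incomparable pairs

Comparable : ∀ {n} → Rel₂ n → Fin n → Fin n → Set
Comparable U a b = U a b ≡ true ⊎ U b a ≡ true

module _ {n : ℕ} (U : Rel₂ n) where

  incomparable : Fin n → Fin n → Bool
  incomparable a b = not (U a b ∨ U b a)

  incomparable-sym : ∀ a b → incomparable a b ≡ incomparable b a
  incomparable-sym a b = cong not (∨-comm (U a b) (U b a))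

  incomparable⇒Unrelated : ∀ a b → incomparable a b ≡ true → Unrelated U a b
  incomparable⇒Unrelated a b eq with U a b | U b a
  incomparable⇒Unrelated a b () | true | _
  incomparable⇒Unrelated a b () | false | true
  ... | false | false = refl , refl

  Unrelated⇒incomparable : ∀ a b → Unrelated U a b → incomparable a b ≡ true
  Unrelated⇒incomparable a b (ab , ba) rewrite ab | ba = refl

  ¬incomparable⇒Comparable : ∀ a b → incomparable a b ≡ false → Comparable U a b
  ¬incomparable⇒Comparable a b eq with U a b | U b a
  ... | true | _ = inj₁ refl
  ... | false | true = inj₂ refl
  ¬incomparable⇒Comparable a b () | false | false

  incomparablePairs : List (Fin n) → ℕ
  incomparablePairs [] = 0
  incomparablePairs (a ∷ w) = count (incomparable a) w + incomparablePairs w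

  crossIncomparable : List (Fin n) → List (Fin n) → ℕ
  crossIncomparable v w = sum (map (λ a → count (incomparable a) w) v)

  selfIncomparable : List (Fin n) → ℕ
  selfIncomparable = count (λ a → incomparable a a)

  crossIncomparable-∷ʳ : ∀ v a w →
                         crossIncomparable v (a ∷ w) ≡ count (incomparable a) v + crossIncomparable v w
  crossIncomparable-∷ʳ [] a w = refl
  crossIncomparable-∷ʳ (b ∷ v) a w
    rewrite crossIncomparable-∷ʳ v a w | incomparable-sym a b =
    regroup (if incomparable b a then 1 else 0) (count (incomparable b) w) (count (incomparable a) v) _
    where
    regroup : ∀ x p q r → x + p + (q + r) ≡ x + q + (p + r)
    regroup = solve-∀

  -- crossIncomparable w w counts ordered pairs of positions: each incomparable pair twice, plus the
  -- diagonal.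
  incomparablePairs-double : ∀ w → incomparablePairs w * 2 + selfIncomparable w ≡ crossIncomparable w w
  incomparablePairs-double [] = refl
  incomparablePairs-double (a ∷ w) = begin
    (c + incomparablePairs w) * 2 + (d + selfIncomparable w)
      ≡⟨ regroup c (incomparablePairs w) d (selfIncomparable w) ⟩
    (d + c) + (c + (incomparablePairs w * 2 + selfIncomparable w))
      ≡⟨ cong (λ t → d + c + (c + t)) (incomparablePairs-double w) ⟩
    (d + c) + (c + crossIncomparable w w)
      ≡⟨ cong (d + c +_) (sym (crossIncomparable-∷ʳ w a w)) ⟩
    crossIncomparable (a ∷ w) (a ∷ w) ∎
    where
    open ≡-Reasoning
    c = count (incomparable a) w
    d = if incomparable a a then 1 else 0
    regroup : ∀ c i d e → (c + i) * 2 + (d + e) ≡ (d + c) + (c + (i * 2 + e))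
    regroup = solve-∀

  crossIncomparable-content : ∀ {v v′ w w′} → SameContent v v′ → SameContent w w′ →
                              crossIncomparable v w ≡ crossIncomparable v′ w′
  crossIncomparable-content {v} {v′} {w} {w′} v~v′ w~w′ = begin
    sum (map (λ a → count (incomparable a) w) v)
      ≡⟨ cong sum (map-cong (λ a → count-content (incomparable a) w~w′) v) ⟩
    sum (map (λ a → count (incomparable a) w′) v)
      ≡⟨ sum-map-content _ v~v′ ⟩
    sum (map (λ a → count (incomparable a) w′) v′) ∎
    where open ≡-Reasoning

  incomparablePairs-content : ∀ {v w} → SameContent v w → incomparablePairs v ≡ incomparablePairs w
  incomparablePairs-content {v} {w} v~w = *-cancelʳ-≡ _ _ 2 (+-cancelʳ-≡ (selfIncomparable w) _ _ (begin
    incomparablePairs v * 2 + selfIncomparable w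
      ≡⟨ cong (incomparablePairs v * 2 +_) (sym (count-content _ v~w)) ⟩
    incomparablePairs v * 2 + selfIncomparable v   ≡⟨ incomparablePairs-double v ⟩
    crossIncomparable v v                          ≡⟨ crossIncomparable-content v~w v~w ⟩
    crossIncomparable w w                          ≡⟨ sym (incomparablePairs-double w) ⟩
    incomparablePairs w * 2 + selfIncomparable w   ∎))
    where open ≡-Reasoning

-- inv' and maj' against the number of pairs of positions

pairs : ℕ → ℕ
pairs zero = 0
pairs (suc m) = m + pairs m

positionSum : ℕ → ℕ → ℕ
positionSum k zero = 0
positionSum k (suc zero) = 0
positionSum k (suc (suc m)) = k + positionSum (suc k) (suc m)

positionSum-suc : ∀ k m → positionSum (suc k) (suc m) ≡ m + positionSum k (suc m)
positionSum-suc k zero = refl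
positionSum-suc k (suc m) rewrite positionSum-suc (suc k) m =
  regroup k m (positionSum (suc k) (suc m))
  where
  regroup : ∀ k m p → suc k + (m + p) ≡ suc m + (k + p)
  regroup = solve-∀

positionSum-one : ∀ m → positionSum 1 m ≡ pairs m
positionSum-one zero = refl
positionSum-one (suc m) =
  trans (positionSum-suc 0 m) (cong (m +_) (trans (shift m) (positionSum-one m)))
  where
  shift : ∀ m → positionSum 0 (suc m) ≡ positionSum 1 m
  shift zero = refl
  shift (suc m) = refl

module _ {n : ℕ} (U : Rel₂ n) where

  count+count-incomparable≤length : ∀ a w → count (U a) w + count (incomparable U a) w ≤ length w
  count+count-incomparable≤length a [] = z≤n
  count+count-incomparable≤length a (b ∷ w) with U a b | U b a
  ... | true | _ = s≤s (count+count-incomparable≤length a w)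
  ... | false | true = m≤n⇒m≤1+n (count+count-incomparable≤length a w)
  ... | false | false =
    ≤-trans (≤-reflexive (+-suc _ _)) (s≤s (count+count-incomparable≤length a w))

  inv'+incomparablePairs≤pairs : ∀ w → inv' U w + incomparablePairs U w ≤ pairs (length w)
  inv'+incomparablePairs≤pairs [] = z≤n
  inv'+incomparablePairs≤pairs (a ∷ w) = begin
    count (U a) w + inv' U w + (count (incomparable U a) w + incomparablePairs U w)
      ≡⟨ regroup (count (U a) w) (inv' U w) _ _ ⟩
    count (U a) w + count (incomparable U a) w + (inv' U w + incomparablePairs U w)
      ≤⟨ +-mono-≤ (count+count-incomparable≤length a w) (inv'+incomparablePairs≤pairs w) ⟩
    length w + pairs (length w) ∎
    where
    open ≤-Reasoning
    regroup : ∀ a b c d → a + b + (c + d) ≡ a + c + (b + d)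
    regroup = solve-∀

  comajFrom : ℕ → List (Fin n) → ℕ
  comajFrom k [] = 0
  comajFrom k (a ∷ []) = 0
  comajFrom k (a ∷ b ∷ w) = (if U a b then 0 else k) + comajFrom (suc k) (b ∷ w)

  majFrom+comajFrom : ∀ k w → majFrom U k w + comajFrom k w ≡ positionSum k (length w)
  majFrom+comajFrom k [] = refl
  majFrom+comajFrom k (a ∷ []) = refl
  majFrom+comajFrom k (a ∷ b ∷ w) =
    trans (split (U a b)) (cong (k +_) (majFrom+comajFrom (suc k) (b ∷ w)))
    where
    m = majFrom U (suc k) (b ∷ w)
    c = comajFrom (suc k) (b ∷ w)
    split : ∀ t → (if t then k else 0) + m + ((if t then 0 else k) + c) ≡ k + (m + c)
    split true = +-assoc k m c
    split false = regroup m k c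
      where
      regroup : ∀ m k c → m + (k + c) ≡ k + (m + c)
      regroup = solve-∀

  maj'+comaj≡pairs : ∀ w → maj' U w + comajFrom 1 w ≡ pairs (length w)
  maj'+comaj≡pairs w = trans (majFrom+comajFrom 1 w) (positionSum-one (length w))

  incomparablePairs≤comaj : ∀ {v w} → SameContent v w → inv' U v ≡ maj' U w →
                            incomparablePairs U w ≤ comajFrom 1 w
  incomparablePairs≤comaj {v} {w} v~w inv'≡maj' = +-cancelˡ-≤ (inv' U v) _ _ (begin
    inv' U v + incomparablePairs U w
      ≡⟨ cong (inv' U v +_) (sym (incomparablePairs-content U v~w)) ⟩
    inv' U v + incomparablePairs U v  ≤⟨ inv'+incomparablePairs≤pairs v ⟩
    pairs (length v)                  ≡⟨ cong pairs (length-content v~w) ⟩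
    pairs (length w)                  ≡⟨ sym (maj'+comaj≡pairs w) ⟩
    maj' U w + comajFrom 1 w          ≡⟨ cong (_+ comajFrom 1 w) (sym inv'≡maj') ⟩
    inv' U v + comajFrom 1 w          ∎)
    where open ≤-Reasoning

  comajFrom-++ : ∀ k v w → (∀ j → comajFrom j w ≡ 0) →
                 comajFrom (suc k) (v ++ w) ≤ comajFrom (suc k) v + (k + length v)
  comajFrom-++ k [] w free rewrite free (suc k) = z≤n
  comajFrom-++ k (a ∷ []) [] free = z≤n
  comajFrom-++ k (a ∷ []) (b ∷ w) free
    rewrite free (suc (suc k)) | +-identityʳ (if U a b then 0 else suc k) | +-comm k 1
    with U a b
  ... | true = z≤n
  ... | false = ≤-refl
  comajFrom-++ k (a ∷ a′ ∷ v) w free = begin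
    t + comajFrom (suc (suc k)) (a′ ∷ v ++ w)
      ≤⟨ +-monoʳ-≤ t (comajFrom-++ (suc k) (a′ ∷ v) w free) ⟩
    t + (comajFrom (suc (suc k)) (a′ ∷ v) + (suc k + suc (length v)))
      ≡⟨ cong (λ l → t + (comajFrom (suc (suc k)) (a′ ∷ v) + l)) (sym (+-suc k (suc (length v)))) ⟩
    t + (comajFrom (suc (suc k)) (a′ ∷ v) + (k + suc (suc (length v))))
      ≡⟨ sym (+-assoc t _ _) ⟩
    t + comajFrom (suc (suc k)) (a′ ∷ v) + (k + suc (suc (length v))) ∎
    where
    open ≤-Reasoning
    t = if U a a′ then 0 else suc k

module _ {A : Set} where

  All-insert : ∀ {P : A → Set} xs ys {y} → All P (xs ++ ys) → P y → All P (xs ++ y ∷ ys)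
  All-insert [] ys ps py = py ∷ ps
  All-insert (x ∷ xs) ys (px ∷ ps) py = px ∷ All-insert xs ys ps py

  Unique-insert : ∀ xs ys {y} → Unique (xs ++ ys) → y ∉ xs ++ ys → Unique (xs ++ y ∷ ys)
  Unique-insert [] ys u y∉ =
    All.tabulate (λ y′∈ y≡y′ → y∉ (subst (_∈ ys) (sym y≡y′) y′∈)) ∷ u
  Unique-insert (x ∷ xs) ys (x∉ ∷ u) y∉ =
    All-insert xs ys x∉ (λ x≡y → y∉ (here (sym x≡y))) ∷ Unique-insert xs ys u (y∉ ∘ there)

  Linked-insert : ∀ {R : A → A → Set} xs ys {y} → Linked R (xs ++ ys) →
                  Connected R (last xs) (just y) → Connected R (just y) (head ys) →
                  Linked R (xs ++ y ∷ ys)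
  Linked-insert [] [] _ _ _ = [-]
  Linked-insert [] (_ ∷ _) l _ (just r) = r ∷ l
  Linked-insert (x ∷ []) ys l (just r) ry = r ∷ Linked-insert [] ys (Linked.tail l) nothing-just ry
  Linked-insert (x ∷ x′ ∷ xs) ys (r ∷ l) rx ry = r ∷ Linked-insert (x′ ∷ xs) ys l rx ry

  last-∷ʳ : ∀ xs (x : A) → last (xs ++ [ x ]) ≡ just x
  last-∷ʳ [] x = refl
  last-∷ʳ (_ ∷ []) x = refl
  last-∷ʳ (_ ∷ _ ∷ xs) x = last-∷ʳ (_ ∷ xs) x

-- Vertices of (α, U)

module _ {n : ℕ} {α : Fin n → ℕ} where

  occ-map-val : ∀ i (vs : List (Vertex α)) →
                occ i (map val vs) ≡ length (filter (λ v → i Fin.≟ val v) vs)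
  occ-map-val i [] = refl
  occ-map-val i (v ∷ vs) with i Fin.≟ val v
  ... | yes _ = cong suc (occ-map-val i vs)
  ... | no _ = occ-map-val i vs

  occ-↭ : ∀ i {vs ws : List (Vertex α)} → vs ↭ ws → occ i (map val vs) ≡ occ i (map val ws)
  occ-↭ i p = ↭.↭-length (↭.filter-↭ (i Fin.≟_) (↭.map⁺ val p))

  -- The vertices of value i in a duplicate-free list of all vertices are, up to order, the copies
  -- (i , 0) … (i , α i − 1).
  occ-map-val-complete : ∀ {vs : List (Vertex α)} → Unique vs → (∀ v → v ∈ vs) →
                         ∀ i → occ i (map val vs) ≡ α i
  occ-map-val-complete {vs} unique complete i = begin
    occ i (map val vs)                   ≡⟨ occ-map-val i vs ⟩
    length (filter (λ v → i Fin.≟ val v) vs)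
      ≡⟨ ↭.↭-length (∼bag⇒↭ (unique∧set⇒bag (Unique.filter⁺ _ unique) copies-unique
                                              (mk⇔ to from))) ⟩
    length copies                        ≡⟨ length-map copy (allFin (α i)) ⟩
    length (allFin (α i))                ≡⟨ length-tabulate (λ k → k) ⟩
    α i                                  ∎
    where
    open ≡-Reasoning
    copy : Fin (α i) → Vertex α
    copy k = i , k
    copies : List (Vertex α)
    copies = map copy (allFin (α i))
    copies-unique : Unique copies
    copies-unique = Unique.map⁺ (λ { refl → refl }) (Unique.allFin⁺ (α i))
    to : ∀ {v} → v ∈ filter (λ v → i Fin.≟ val v) vs → v ∈ copies
    to {j , k} v∈ with proj₂ (∈-filter⁻ (λ v → i Fin.≟ val v) {xs = vs} v∈)
    ... | refl = ∈-map⁺ copy (∈-allFin k)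
    from : ∀ {v} → v ∈ copies → v ∈ filter (λ v → i Fin.≟ val v) vs
    from v∈ with ∈-map⁻ copy v∈
    ... | k , _ , refl = ∈-filter⁺ (λ v → i Fin.≟ val v) (complete _) refl

  vertices : List (List (Vertex α)) → List (Vertex α)
  vertices [] = []
  vertices (c ∷ cs) = vertices cs ++ c

  vertices-↭ : ∀ ws → vertices ws ↭ concat ws
  vertices-↭ [] = ↭-refl
  vertices-↭ (c ∷ cs) = ↭-trans (↭.++-comm (vertices cs) c) (↭.++⁺ˡ c (vertices-↭ cs))

  chainWord : List (List (Vertex α)) → List (Fin n)
  chainWord ws = map val (vertices ws)

  module _ {U : Rel₂ n} where

    MaxChainSeq-unique : ∀ {used : List (Vertex α)} {ws} → MaxChainSeq U used ws →
                         Unique used → Unique (used ++ concat ws)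
    MaxChainSeq-unique {used} (done _) u = subst Unique (sym (++-identityʳ used)) u
    MaxChainSeq-unique {used} (step {c} {cs} _ c-chain c-avoids _ rest) u =
      subst Unique (++-assoc used c (concat cs))
        (MaxChainSeq-unique rest
          (Unique.++⁺ u (proj₁ c-chain) (λ (v∈used , v∈c) → All.lookup c-avoids v∈c v∈used)))

    MaxChainSeq-complete : ∀ {used : List (Vertex α)} {ws} → MaxChainSeq U used ws →
                           ∀ v → v ∈ used ++ concat ws
    MaxChainSeq-complete {used} (done all) v = ∈-++⁺ˡ (all v)
    MaxChainSeq-complete {used} (step {c} {cs} _ _ _ _ rest) v =
      subst (v ∈_) (++-assoc used c (concat cs)) (MaxChainSeq-complete rest v)

    MaxChainSeq-avoids : ∀ {used : List (Vertex α)} {ws} → MaxChainSeq U used ws →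
                         All (_∉ used) (vertices ws)
    MaxChainSeq-avoids (done _) = []
    MaxChainSeq-avoids (step {c} {cs} _ _ c-avoids _ rest) =
      All.++⁺ (All.map (λ v∉ → v∉ ∘ ∈-++⁺ˡ) (MaxChainSeq-avoids rest)) c-avoids

    chainWord∈R : ∀ {ws} → MaxChains U ws → chainWord ws ∈ R α
    chainWord∈R {ws} chains = ∈R⁺ λ i →
      trans (occ-↭ i (vertices-↭ ws))
            (occ-map-val-complete (MaxChainSeq-unique chains []) (MaxChainSeq-complete chains) i)

-- A vertex outside a chain of maximum length

count≡0⇒false : ∀ {n} {A : Set} (g : A → Fin n) (f : Fin n → Bool) xs →
                count f (map g xs) ≡ 0 → ∀ s → f (g (lookup xs s)) ≡ false
count≡0⇒false g f (x ∷ xs) none s with f (g x) in fx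
count≡0⇒false g f (x ∷ xs) () s | true
count≡0⇒false g f (x ∷ xs) none zero | false = fx
count≡0⇒false g f (x ∷ xs) none (suc s) | false = count≡0⇒false g f xs none s

count≡1⇒unique : ∀ {n} {A : Set} (g : A → Fin n) (f : Fin n → Bool) xs → count f (map g xs) ≡ 1 →
                 Σ (Fin (length xs)) λ r →
                   f (g (lookup xs r)) ≡ true × (∀ s → s ≢ r → f (g (lookup xs s)) ≡ false)
count≡1⇒unique g f (x ∷ xs) one with f (g x) in fx
... | true = zero , fx , elsewhere
  where
  elsewhere : ∀ s → s ≢ zero → f (g (lookup (x ∷ xs) s)) ≡ false
  elsewhere zero s≢0 = ⊥-elim (s≢0 refl)
  elsewhere (suc s) _ = count≡0⇒false g f xs (suc-injective one) s
... | false with count≡1⇒unique g f xs one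
... | r , at-r , elsewhere = suc r , at-r , elsewhere′
  where
  elsewhere′ : ∀ s → s ≢ suc r → f (g (lookup (x ∷ xs) s)) ≡ false
  elsewhere′ zero _ = fx
  elsewhere′ (suc s) s≢r = elsewhere s (s≢r ∘ cong suc)

Straddles : ∀ {n} {α : Fin n → ℕ} → Rel₂ n → Vertex α → List (Vertex α) → Set
Straddles U y c = Σ (Fin (length c)) λ r →
    Unrelated U (val y) (val (lookup c r))
  × ((r′ : Fin (length c)) → Unrelated U (val y) (val (lookup c r′)) → r′ ≡ r)
  × ((s : Fin (length c)) → toℕ s < toℕ r → U (val (lookup c s)) (val y) ≡ true)
  × ((s : Fin (length c)) → toℕ r < toℕ s → U (val y) (val (lookup c s)) ≡ true)

-- Every lemma here comes from one fact: y cannot be inserted into c, as that would give a longer chain.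
module MaximumChain {n} {α : Fin n → ℕ} (U : Rel₂ n) {used c : List (Vertex α)}
  (c-chain : IsChain U c) (c-avoids : All (_∉ used) c)
  (c-maximum : ∀ d → IsChain U d → All (_∉ used) d → length d ≤ length c)
  {y : Vertex α} (y∉used : y ∉ used) (y∉c : y ∉ c) where

  no-insertion : ∀ A B → A ++ B ≡ c →
                 Connected (Edge U) (last A) (just y) → Connected (Edge U) (just y) (head B) → ⊥
  no-insertion A B refl into out-of = 1+n≰n (begin
    suc (length (A ++ B))  ≡⟨ sym (length-++-sucʳ A y B) ⟩
    length (A ++ y ∷ B)    ≤⟨ c-maximum (A ++ y ∷ B) longer-chain (All-insert A B c-avoids y∉used) ⟩
    length (A ++ B)        ∎)
    where
    open ≤-Reasoning
    longer-chain : IsChain U (A ++ y ∷ B)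
    longer-chain = Unique-insert A B (proj₁ c-chain) y∉c , Linked-insert A B (proj₂ c-chain) into out-of

  private
    in-c : ∀ A B → A ++ B ≡ c → ∀ {a} → a ∈ B → a ∈ c
    in-c A B eq a∈B = subst (_ ∈_) eq (∈-++⁺ʳ A a∈B)

    move-boundary : ∀ A a B → A ++ a ∷ B ≡ c → (A ++ [ a ]) ++ B ≡ c
    move-boundary A a B = trans (++-assoc A [ a ] B)

    edge-out : ∀ {a} → a ∈ c → U (val y) (val a) ≡ true → Edge U y a
    edge-out a∈c y→a = (λ { refl → y∉c a∈c }) , y→a

    edge-in : ∀ {a} → a ∈ c → U (val a) (val y) ≡ true → Edge U a y
    edge-in a∈c a→y = (λ { refl → y∉c a∈c }) , a→y

    last-in : ∀ A {a} → a ∈ c → U (val a) (val y) ≡ true →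
              Connected (Edge U) (last (A ++ [ a ])) (just y)
    last-in A {a} a∈c a→y =
      subst (λ m → Connected (Edge U) m (just y)) (sym (last-∷ʳ A a)) (just (edge-in a∈c a→y))

    head-out : ∀ B → (∀ {a} → a ∈ B → a ∈ c) → (∀ s → U (val y) (val (lookup B s)) ≡ true) →
               Connected (Edge U) (just y) (head B)
    head-out [] _ _ = just-nothing
    head-out (b ∷ B) B⊆c out = just (edge-out (B⊆c (here refl)) (out zero))

  -- Induction from the right: once y points to the rest of B, a first letter b with (b, y) ∈ U would
  -- let y be inserted right after b.
  out-to-suffix : ∀ A B → A ++ B ≡ c → (∀ s → Comparable U (val y) (val (lookup B s))) →
                  ∀ s → U (val y) (val (lookup B s)) ≡ true
  out-to-suffix A (b ∷ B) eq comparable = out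
    where
    eq′ = move-boundary A b B eq
    later : ∀ s → U (val y) (val (lookup B s)) ≡ true
    later = out-to-suffix (A ++ [ b ]) B eq′ (comparable ∘ suc)
    out : ∀ s → U (val y) (val (lookup (b ∷ B) s)) ≡ true
    out zero with comparable zero
    ... | inj₁ y→b = y→b
    ... | inj₂ b→y = ⊥-elim (no-insertion (A ++ [ b ]) B eq′
                                (last-in A (in-c A (b ∷ B) eq (here refl)) b→y)
                                (head-out B (in-c (A ++ [ b ]) B eq′) later))
    out (suc s) = later s

  into-before : ∀ A C → A ++ C ≡ c → Connected (Edge U) (last A) (just y) → (r : Fin (length C)) →
                (∀ s → s ≢ r → Comparable U (val y) (val (lookup C s))) →
                ∀ s → toℕ s < toℕ r → U (val (lookup C s)) (val y) ≡ true
  into-before A (a ∷ C) eq into (suc r) comparable = before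
    where
    a∈c = in-c A (a ∷ C) eq (here refl)
    a→y : U (val a) (val y) ≡ true
    a→y with comparable zero (λ ())
    ... | inj₁ y→a = ⊥-elim (no-insertion A (a ∷ C) eq into (just (edge-out a∈c y→a)))
    ... | inj₂ a→y = a→y
    before : ∀ s → toℕ s < toℕ (suc r) → U (val (lookup (a ∷ C) s)) (val y) ≡ true
    before zero _ = a→y
    before (suc s) (s≤s s<r) =
      into-before (A ++ [ a ]) C (move-boundary A a C eq) (last-in A a∈c a→y) r
                  (λ s s≢r → comparable (suc s) (s≢r ∘ Fin.suc-injective)) s s<r

  out-after : ∀ A C → A ++ C ≡ c → (r : Fin (length C)) →
              (∀ s → s ≢ r → Comparable U (val y) (val (lookup C s))) →
              ∀ s → toℕ r < toℕ s → U (val y) (val (lookup C s)) ≡ true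
  out-after A (a ∷ C) eq zero comparable (suc s) _ =
    out-to-suffix (A ++ [ a ]) C (move-boundary A a C eq) (λ s → comparable (suc s) (λ ())) s
  out-after A (a ∷ C) eq (suc r) comparable (suc s) (s≤s r<s) =
    out-after (A ++ [ a ]) C (move-boundary A a C eq) r
              (λ s s≢r → comparable (suc s) (s≢r ∘ Fin.suc-injective)) s r<s

  some-incomparable : 1 ≤ count (incomparable U (val y)) (map val c)
  some-incomparable with count (incomparable U (val y)) (map val c) in none
  ... | suc _ = s≤s z≤n
  ... | zero = ⊥-elim (no-insertion [] c refl nothing-just
                         (head-out c (λ a∈c → a∈c) (out-to-suffix [] c refl comparable)))
    where
    comparable : ∀ s → Comparable U (val y) (val (lookup c s))
    comparable s = ¬incomparable⇒Comparable U _ _ (count≡0⇒false val _ c none s)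

  straddles : count (incomparable U (val y)) (map val c) ≡ 1 → Straddles U y c
  straddles one with count≡1⇒unique val (incomparable U (val y)) c one
  ... | r , at-r , elsewhere =
    r , incomparable⇒Unrelated U _ _ at-r , only-r ,
    into-before [] c refl nothing-just r comparable , out-after [] c refl r comparable
    where
    comparable : ∀ s → s ≢ r → Comparable U (val y) (val (lookup c s))
    comparable s s≢r = ¬incomparable⇒Comparable U _ _ (elsewhere s s≢r)
    only-r : ∀ r′ → Unrelated U (val y) (val (lookup c r′)) → r′ ≡ r
    only-r r′ unrelated with r′ Fin.≟ r
    ... | yes r′≡r = r′≡r
    ... | no r′≢r with () ← trans (sym (elsewhere r′ r′≢r)) (Unrelated⇒incomparable U _ _ unrelated)

-- Counting incomparable pairs of the maximal chain word

module _ {A : Set} (f : A → ℕ) where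

  length≤sum-map : ∀ {xs} → All (λ x → 1 ≤ f x) xs → length xs ≤ sum (map f xs)
  length≤sum-map [] = z≤n
  length≤sum-map (p ∷ ps) = +-mono-≤ p (length≤sum-map ps)

  sum-map≤length⇒≡1 : ∀ {xs} → All (λ x → 1 ≤ f x) xs → sum (map f xs) ≤ length xs →
                      All (λ x → f x ≡ 1) xs
  sum-map≤length⇒≡1 [] _ = []
  sum-map≤length⇒≡1 {x ∷ xs} (p ∷ ps) bound = ≤-antisym fx≤1 p ∷ sum-map≤length⇒≡1 ps rest≤
    where
    fx≤1 : f x ≤ 1
    fx≤1 = +-cancelʳ-≤ (length xs) _ 1 (≤-trans (+-monoʳ-≤ (f x) (length≤sum-map ps)) bound)
    rest≤ : sum (map f xs) ≤ length xs
    rest≤ = +-cancelˡ-≤ 1 _ _ (≤-trans (+-monoˡ-≤ (sum (map f xs)) p) bound)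

squeeze : ∀ {a b d A L} → a + b + d ≤ A + L → A ≤ a → L ≤ b → d ≡ 0 × b ≤ L × a ≤ A
squeeze {a} {b} {d} {A} {L} bound A≤a L≤b =
  n≤0⇒n≡0 (+-cancelˡ-≤ (a + b) d 0 (≤-trans bound (≤-trans (+-mono-≤ A≤a L≤b)
                                                            (≤-reflexive (sym (+-identityʳ _)))))) ,
  +-cancelˡ-≤ a b L (≤-trans a+b≤A+L (+-monoˡ-≤ L A≤a)) ,
  +-cancelʳ-≤ b a A (≤-trans a+b≤A+L (+-monoʳ-≤ A L≤b))
  where
  a+b≤A+L : a + b ≤ A + L
  a+b≤A+L = ≤-trans (m≤m+n (a + b) d) bound

module _ {n : ℕ} (U : Rel₂ n) where

  count-++ : ∀ (f : Fin n → Bool) v w → count f (v ++ w) ≡ count f v + count f w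
  count-++ f [] w = refl
  count-++ f (a ∷ v) w =
    trans (cong (_ +_) (count-++ f v w)) (sym (+-assoc (if f a then 1 else 0) _ _))

  incomparablePairs-++ : ∀ v w → incomparablePairs U (v ++ w)
                         ≡ incomparablePairs U v + crossIncomparable U v w + incomparablePairs U w
  incomparablePairs-++ [] w = refl
  incomparablePairs-++ (a ∷ v) w rewrite count-++ (incomparable U a) v w | incomparablePairs-++ v w =
    regroup (count (incomparable U a) v) (count (incomparable U a) w) (incomparablePairs U v) _ _
    where
    regroup : ∀ p q i s j → p + q + (i + s + j) ≡ p + i + (q + s) + j
    regroup = solve-∀

module _ {n : ℕ} {α : Fin n → ℕ} (U : Rel₂ n) where

  -- The positions in the chain word at which one chain ends and the next begins, summed.
  boundarySum : List (List (Vertex α)) → ℕ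
  boundarySum [] = 0
  boundarySum (c ∷ cs) = boundarySum cs + length (vertices cs)

  comajFrom-chain : ∀ {c : List (Vertex α)} → Linked (Edge U) c →
                    ∀ j → comajFrom U j (map val c) ≡ 0
  comajFrom-chain [] j = refl
  comajFrom-chain [-] j = refl
  comajFrom-chain ((_ , a→b) ∷ l) j rewrite a→b = comajFrom-chain l (suc j)

  comaj≤boundarySum : ∀ {used : List (Vertex α)} {ws} → MaxChainSeq U used ws →
                      comajFrom U 1 (chainWord ws) ≤ boundarySum ws
  comaj≤boundarySum (done _) = z≤n
  comaj≤boundarySum (step {c} {cs} _ c-chain _ _ rest) = begin
    comajFrom U 1 (map val (vertices cs ++ c))
      ≡⟨ cong (comajFrom U 1) (map-++ val (vertices cs) c) ⟩
    comajFrom U 1 (chainWord cs ++ map val c)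
      ≤⟨ comajFrom-++ U 0 (chainWord cs) (map val c) (comajFrom-chain (proj₂ c-chain)) ⟩
    comajFrom U 1 (chainWord cs) + length (chainWord cs)
      ≤⟨ +-mono-≤ (comaj≤boundarySum rest) (≤-reflexive (length-map val (vertices cs))) ⟩
    boundarySum cs + length (vertices cs) ∎
    where open ≤-Reasoning

  incomparableWith : List (Vertex α) → Vertex α → ℕ
  incomparableWith c v = count (incomparable U (val v)) (map val c)

  later-incomparable : ∀ {used : List (Vertex α)} {c cs} → MaxChainSeq U used (c ∷ cs) →
                       All (λ v → 1 ≤ incomparableWith c v) (vertices cs)
  later-incomparable {used} (step _ c-chain c-avoids c-maximum rest) =
    All.map (λ v∉ → MaximumChain.some-incomparable U c-chain c-avoids c-maximum
                                                   (v∉ ∘ ∈-++⁺ˡ) (v∉ ∘ ∈-++⁺ʳ used))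
            (MaxChainSeq-avoids rest)

  crossIncomparable-chainWord : ∀ cs (c : List (Vertex α)) →
    crossIncomparable U (chainWord cs) (map val c) ≡ sum (map (incomparableWith c) (vertices cs))
  crossIncomparable-chainWord cs c =
    cong sum (sym (map-∘ {g = λ a → count (incomparable U a) (map val c)} (vertices cs)))

  length≤crossIncomparable : ∀ {used : List (Vertex α)} {c cs} → MaxChainSeq U used (c ∷ cs) →
                             length (vertices cs) ≤ crossIncomparable U (chainWord cs) (map val c)
  length≤crossIncomparable {c = c} {cs} seq =
    subst (length (vertices cs) ≤_) (sym (crossIncomparable-chainWord cs c))
          (length≤sum-map (incomparableWith c) (later-incomparable seq))

  boundarySum≤incomparablePairs : ∀ {used : List (Vertex α)} {ws} → MaxChainSeq U used ws →
                                  boundarySum ws ≤ incomparablePairs U (chainWord ws)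
  boundarySum≤incomparablePairs (done _) = z≤n
  boundarySum≤incomparablePairs seq@(step {c} {cs} _ _ _ _ rest) = begin
    boundarySum cs + length (vertices cs)
      ≤⟨ +-mono-≤ (boundarySum≤incomparablePairs rest) (length≤crossIncomparable seq) ⟩
    incomparablePairs U (chainWord cs) + crossIncomparable U (chainWord cs) (map val c)
      ≤⟨ m≤m+n _ _ ⟩
    incomparablePairs U (chainWord cs) + crossIncomparable U (chainWord cs) (map val c)
      + incomparablePairs U (map val c)
      ≡⟨ sym (incomparablePairs-++ U (chainWord cs) (map val c)) ⟩
    incomparablePairs U (chainWord cs ++ map val c)
      ≡⟨ cong (incomparablePairs U) (sym (map-++ val (vertices cs) c)) ⟩
    incomparablePairs U (chainWord (c ∷ cs)) ∎
    where open ≤-Reasoning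

  Tight : List (List (Vertex α)) → Set
  Tight [] = ⊤
  Tight (c ∷ cs) = incomparablePairs U (map val c) ≡ 0
                 × All (λ v → incomparableWith c v ≡ 1) (vertices cs)
                 × Tight cs

  -- Equality in boundarySum ≤ incomparablePairs forces equality in each of its estimates.
  tight : ∀ {used : List (Vertex α)} {ws} → MaxChainSeq U used ws →
          incomparablePairs U (chainWord ws) ≤ boundarySum ws → Tight ws
  tight (done _) _ = tt
  tight seq@(step {c} {cs} _ _ _ _ rest) bound
    with squeeze (subst (_≤ boundarySum cs + length (vertices cs)) split bound)
                 (boundarySum≤incomparablePairs rest) (length≤crossIncomparable seq)
    where
    split : incomparablePairs U (chainWord (c ∷ cs))
          ≡ incomparablePairs U (chainWord cs) + crossIncomparable U (chainWord cs) (map val c)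
            + incomparablePairs U (map val c)
    split = trans (cong (incomparablePairs U) (map-++ val (vertices cs) c))
                  (incomparablePairs-++ U (chainWord cs) (map val c))
  ... | c-incomparable≡0 , cross≤length , rest-bound =
    c-incomparable≡0 ,
    sum-map≤length⇒≡1 (incomparableWith c) (later-incomparable seq)
      (subst (_≤ length (vertices cs)) (crossIncomparable-chainWord cs c) cross≤length) ,
    tight rest rest-bound

  incomparablePairs≡0⇒comparable : ∀ (c : List (Vertex α)) → incomparablePairs U (map val c) ≡ 0 →
    ∀ r s → toℕ r < toℕ s → Comparable U (val (lookup c r)) (val (lookup c s))
  incomparablePairs≡0⇒comparable (a ∷ c) none zero (suc s) _ =
    ¬incomparable⇒Comparable U _ _ (count≡0⇒false val (incomparable U (val a)) c (m+n≡0⇒m≡0 _ none) s)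
  incomparablePairs≡0⇒comparable (a ∷ c) none (suc r) (suc s) (s≤s r<s) =
    incomparablePairs≡0⇒comparable c (m+n≡0⇒n≡0 (incomparableWith c a) none) r s r<s

  tight⇒comparable : ∀ ws → Tight ws →
                     (j : Fin (length ws)) (r s : Fin (length (lookup ws j))) → toℕ r < toℕ s →
                     Comparable U (val (lookup (lookup ws j) r)) (val (lookup (lookup ws j) s))
  tight⇒comparable (c ∷ cs) (none , _ , _) zero = incomparablePairs≡0⇒comparable c none
  tight⇒comparable (c ∷ cs) (_ , _ , rest) (suc j) = tight⇒comparable cs rest j

  lookup∈vertices : ∀ (cs : List (List (Vertex α))) i p → lookup (lookup cs i) p ∈ vertices cs
  lookup∈vertices (c ∷ cs) zero p = ∈-++⁺ʳ (vertices cs) (∈-lookup p)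
  lookup∈vertices (c ∷ cs) (suc i) p = ∈-++⁺ˡ (lookup∈vertices cs i p)

  tight⇒straddles : ∀ {used : List (Vertex α)} {ws} → MaxChainSeq U used ws → Tight ws →
    (i j : Fin (length ws)) → toℕ j < toℕ i → (p : Fin (length (lookup ws i))) →
    Straddles U (lookup (lookup ws i) p) (lookup ws j)
  tight⇒straddles {used} {c ∷ cs} (step _ c-chain c-avoids c-maximum rest) (_ , ones , _) (suc i) zero _ p =
    MaximumChain.straddles U c-chain c-avoids c-maximum (y∉ ∘ ∈-++⁺ˡ) (y∉ ∘ ∈-++⁺ʳ used)
                           (All.lookup ones y∈)
    where
    y∈ = lookup∈vertices cs i p
    y∉ = All.lookup (MaxChainSeq-avoids rest) y∈
  tight⇒straddles (step _ _ _ _ rest) (_ , _ , tight-rest) (suc i) (suc j) (s≤s j<i) p =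
    tight⇒straddles rest tight-rest i j j<i p

  incomparablePairs≤boundarySum : Equidistributed U α → ∀ {ws} → MaxChains U ws →
                                  incomparablePairs U (chainWord ws) ≤ boundarySum ws
  incomparablePairs≤boundarySum equi {ws} chains =
    let w∈R = chainWord∈R chains
        (v , v∈R , inv'≡maj') = ∃-inv'≡maj' equi w∈R
        v~w : SameContent v (chainWord ws)
        v~w = same-content (λ i → trans (∈R⁻ v∈R i) (sym (∈R⁻ w∈R i)))
    in ≤-trans (incomparablePairs≤comaj U v~w inv'≡maj') (comaj≤boundarySum chains)

lemma3p3 : (n : ℕ) (α : Fin n → ℕ) (U : Rel₂ n) →
  Equidistributed U α →
  (ws : List (List (Vertex α))) → MaxChains U ws →
  ((j : Fin (length ws)) (r s : Fin (length (lookup ws j))) → toℕ r < toℕ s →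
    U (val (lookup (lookup ws j) r)) (val (lookup (lookup ws j) s)) ≡ true
    ⊎ U (val (lookup (lookup ws j) s)) (val (lookup (lookup ws j) r)) ≡ true)
  ×
  ((i j : Fin (length ws)) → toℕ j < toℕ i →
    (p : Fin (length (lookup ws i))) →
    Σ (Fin (length (lookup ws j))) (λ r →
      Unrelated U (val (lookup (lookup ws i) p)) (val (lookup (lookup ws j) r))
      × ((r′ : Fin (length (lookup ws j))) →
          Unrelated U (val (lookup (lookup ws i) p)) (val (lookup (lookup ws j) r′)) →
          r′ ≡ r)
      × ((s : Fin (length (lookup ws j))) → toℕ s < toℕ r →
          U (val (lookup (lookup ws j) s)) (val (lookup (lookup ws i) p)) ≡ true)
      × ((s : Fin (length (lookup ws j))) → toℕ r < toℕ s →
          U (val (lookup (lookup ws i) p)) (val (lookup (lookup ws j) s)) ≡ true)))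
lemma3p3 n α U equi ws chains = tight⇒comparable U ws tight-ws , tight⇒straddles U chains tight-ws
  where
  tight-ws : Tight U ws
  tight-ws = tight U chains (incomparablePairs≤boundarySum U equi chains)
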